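{- For every integer $n\ge 0$, $$d_n=\sum_{k=0}^{n}(-1)^{(n-k)/2}d_{n,k}\,s_k,$$ where $d_{n,k}=\frac{k+1}{n+1}\binom{n+1}{\frac{n-k}{2}}$ if $n-k$ is even and $d_{n,k}=0$ if $n-k$ is odd (so terms with $n-k$ odd vanish). Moreover, for each $k\ge 0$, $\sum_{n\ge 0}d_{n,k}x^n=x^kC(x^2)^{k+1}$, where $C(x)=\frac{1-\sqrt{1-4x}}{2x}$. Here $d_n$ is the number of symmetric Dyck paths of length $2n$ and $s_n$ is the number of symmetric Schröder paths of length $2n$.
   Context: Steps: up step $U=(1,1)$, down step $D=(1,-1)$, 2-horizontal step $H=(2,0)$. A Dyck path of length $2n$ is a lattice path from $(0,0)$ to $(2n,0)$ using steps $U,D$ that never goes below the $x$-axis; a Schröder path of length $2n$ is the same but steps $U,D,H$ are allowed. A path of length $2n$ is symmetric if it passes through a lattice point with $x$-coordinate $n$ and its part on $[n,2n]$ is the mirror image of its part on $[0,n]$ under the reflection $x\mapsto 2n-x$. Thus $d_n=\binom{n}{\lfloor n/2\rfloor}$ and $s_n$ ($1,1,3,5,13,\dots$) count symmetric Dyck and symmetric Schröder paths of length $2n$ respectively. -}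

module Defs where

open import Data.Bool using (Bool; true; false; _∧_; if_then_else_)
open import Data.Nat using (ℕ; zero; suc; _+_; _*_; _∸_; _/_; _%_; _<ᵇ_; _≡ᵇ_)
open import Data.Nat.Combinatorics using (_C_)
open import Data.Integer as ℤ using (ℤ; +_; -[1+_])
open import Data.List using (List; []; _∷_; _++_; map; length; filterᵇ; reverse)
open import Data.Maybe using (Maybe; just; nothing)
open import Data.Product using (_×_; _,_)

-- U = (1,1), D = (1,-1), H = (2,0)
data Step : Set where
  U D H : Step

width : Step → ℕ
width U = 1
width D = 1
width H = 2

-- all step sequences whose total x-extent is exactly m
paths : ℕ → List (List Step)
paths zero = [] ∷ []
paths (suc zero) = (U ∷ []) ∷ (D ∷ []) ∷ []
paths (suc (suc m)) =
  map (U ∷_) (paths (suc m)) ++ map (D ∷_) (paths (suc m)) ++ map (H ∷_) (paths m)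

validFrom : ℕ → List Step → Bool
validFrom zero    []       = true
validFrom (suc h) []       = false
validFrom h       (U ∷ p)  = validFrom (suc h) p
validFrom zero    (D ∷ p)  = false
validFrom (suc h) (D ∷ p)  = validFrom h p
validFrom h       (H ∷ p)  = validFrom h p

noH : List Step → Bool
noH []      = true
noH (H ∷ p) = false
noH (_ ∷ p) = noH p

isSchroeder : List Step → Bool
isSchroeder p = validFrom 0 p

isDyck : List Step → Bool
isDyck p = noH p ∧ validFrom 0 p

splitAtX : ℕ → List Step → Maybe (List Step × List Step)
splitAtX zero    p        = just ([] , p)
splitAtX (suc n) []       = nothing
splitAtX (suc n) (U ∷ p)  with splitAtX n p
... | just (a , b) = just (U ∷ a , b)
... | nothing      = nothing
splitAtX (suc n) (D ∷ p)  with splitAtX n p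
... | just (a , b) = just (D ∷ a , b)
... | nothing      = nothing
splitAtX (suc zero) (H ∷ p) = nothing
splitAtX (suc (suc n)) (H ∷ p) with splitAtX n p
... | just (a , b) = just (H ∷ a , b)
... | nothing      = nothing

flipStep : Step → Step
flipStep U = D
flipStep D = U
flipStep H = H

mirror : List Step → List Step
mirror p = reverse (map flipStep p)

stepEq : Step → Step → Bool
stepEq U U = true
stepEq D D = true
stepEq H H = true
stepEq _ _ = false

listEq : List Step → List Step → Bool
listEq []      []      = true
listEq (x ∷ p) (y ∷ q) = stepEq x y ∧ listEq p q
listEq _       _       = false

isSymmetric : ℕ → List Step → Bool
isSymmetric n p with splitAtX n p
... | just (a , b) = listEq b (mirror a)
... | nothing      = false

dSym : ℕ → ℕ
dSym n = length (filterᵇ (λ p → isDyck p ∧ isSymmetric n p) (paths (2 * n)))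

sSym : ℕ → ℕ
sSym n = length (filterᵇ (λ p → isSchroeder p ∧ isSymmetric n p) (paths (2 * n)))

-- d_{n,k} = (k+1)/(n+1) * binom(n+1, (n-k)/2) if n-k is even (and ≥ 0), else 0.
-- (The quotient is exact; for k > n the binomial formula gives 0.)
dnk : ℕ → ℕ → ℕ
dnk n k =
  if n <ᵇ k then 0
  else if ((n ∸ k) % 2) ≡ᵇ 0
       then ((k + 1) * (suc n C ((n ∸ k) / 2))) / suc n
       else 0

negOnePow : ℕ → ℤ
negOnePow m = -[1+ 0 ] ℤ.^ m

sumTo : ℕ → (ℕ → ℤ) → ℤ
sumTo zero    f = f 0
sumTo (suc n) f = sumTo n f ℤ.+ f (suc n)

Series : Set
Series = ℕ → ℤ

_⊛_ : Series → Series → Series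
(f ⊛ g) n = sumTo n (λ i → f i ℤ.* g (n ∸ i))

oneS : Series
oneS zero    = + 1
oneS (suc _) = + 0

xS : Series
xS (suc zero) = + 1
xS _          = + 0

powS : Series → ℕ → Series
powS f zero    = oneS
powS f (suc k) = f ⊛ powS f k

_−S_ : Series → Series → Series
(f −S g) n = f n ℤ.- g n

scaleS : ℤ → Series → Series
scaleS c f n = c ℤ.* f n

oneMinus4x : Series
oneMinus4x zero          = + 1
oneMinus4x (suc zero)    = -[1+ 3 ]
oneMinus4x (suc (suc _)) = + 0

subX2 : Series → Series
subX2 f n = if (n % 2) ≡ᵇ 0 then f (n / 2) else + 0

module Submission where

-- A symmetric path of length 2n is determined by its first half: a step sequence of
-- width n that never goes below the axis (using no H steps in the Dyck case).  So d_n
-- and s_k count such walks from height 0.  Walks satisfy linear recursions in the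
-- starting height: a Dyck walk steps to h ± 1, a Schröder walk may also make a flat
-- step of width 2.  Summation by parts (the transfer theorem) shows that two families
-- with these recursions are related by the signed ballot triangle, whose entries are
-- (-1)^((n-k)/2) times the ballot numbers, and the closed form
-- (n+1) ballot(n,k) = (k+1) binom(n+1,(n-k)/2) identifies the ballot numbers with d_{n,k}.
-- For the generating function, the hypotheses force C = 1 + xC²; hence
-- C^(k+1) = C^k + x C^(k+2) is the ballot recursion, [x^j] C^(k+1) = ballot(k+2j, k),
-- and substituting x ↦ x² and multiplying by x^k gives the series of d_{n,k}.

module Sequences where
  open import Data.Nat using (ℕ; zero; suc; _*_; _%_; _/_; s≤s)
  open import Data.Nat.DivMod using (m≡m%n+[m/n]*n; m%n<n)
  open import Relation.Binary.PropositionalEquality using (_≡_; subst; sym)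

  lower : {A : Set} → A → (ℕ → A) → ℕ → A
  lower z f zero    = z
  lower z f (suc i) = f i

  parityCases : ∀ {ℓ} (P : ℕ → Set ℓ) →
    (∀ j → P (j * 2)) → (∀ j → P (suc (j * 2))) → ∀ r → P r
  parityCases P even odd r with r % 2 | m≡m%n+[m/n]*n r 2 | m%n<n r 2
  ... | 0           | r≡ | _ = subst P (sym r≡) (even (r / 2))
  ... | 1           | r≡ | _ = subst P (sym r≡) (odd (r / 2))
  ... | suc (suc _) | _  | s≤s (s≤s ())

module Ballot where
  open import Data.Nat
  open import Data.Nat.Properties
  open import Data.Nat.Combinatorics using (_C_; nCk+nC[k+1]≡[n+1]C[k+1]; k>n⇒nCk≡0; nCk≡nC[n∸k])
  open import Data.Nat.DivMod using (m*n%n≡0; m*n/n≡m; [m+kn]%n≡m%n)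
  open import Data.Nat.Tactic.RingSolver using (solve-∀)
  open import Data.Bool using (true; false; if_then_else_; T)
  open import Data.Unit using (tt)
  open import Relation.Nullary using (yes; no; contradiction)
  open import Relation.Binary.PropositionalEquality
  open ≡-Reasoning
  open import Defs using (dnk)
  open Sequences

  -- Binomial coefficients by Pascal's rule; unlike the library's _C_ they compute
  -- by pattern matching, which keeps the inductions below definitional.
  binom : ℕ → ℕ → ℕ
  binom n       zero    = 1
  binom zero    (suc k) = 0
  binom (suc n) (suc k) = binom n k + binom n (suc k)

  binom≡C : ∀ n k → binom n k ≡ n C k
  binom≡C n       zero    = refl
  binom≡C zero    (suc k) = sym (k>n⇒nCk≡0 {0} {suc k} (s≤s z≤n))
  binom≡C (suc n) (suc k) =
    trans (cong₂ _+_ (binom≡C n k) (binom≡C n (suc k))) (nCk+nC[k+1]≡[n+1]C[k+1] n k)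

  pascal : ∀ n j → binom (suc n) j ≡ lower 0 (binom n) j + binom n j
  pascal n zero    = refl
  pascal n (suc j) = refl

  binom-sym : ∀ a b → binom (a + b) a ≡ binom (a + b) b
  binom-sym a b = begin
    binom (a + b) a         ≡⟨ binom≡C (a + b) a ⟩
    (a + b) C a             ≡⟨ nCk≡nC[n∸k] (m≤m+n a b) ⟩
    (a + b) C (a + b ∸ a)   ≡⟨ cong ((a + b) C_) (m+n∸m≡n a b) ⟩
    (a + b) C b             ≡⟨ sym (binom≡C (a + b) b) ⟩
    binom (a + b) b         ∎

  absorption : ∀ n j → suc j * binom (suc n) (suc j) ≡ suc n * binom n j
  absorption zero    zero    = refl
  absorption zero    (suc j) = *-zeroʳ (suc (suc j))
  absorption (suc n) zero    = begin
    1 * binom (suc (suc n)) 1  ≡⟨ *-identityˡ _ ⟩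
    1 + binom (suc n) 1        ≡⟨ cong (1 +_) (trans (sym (*-identityˡ _)) (absorption n 0)) ⟩
    suc (suc n) * 1            ∎
  absorption (suc n) (suc j) = begin
    suc (suc j) * (b (suc j) + b (suc (suc j)))
      ≡⟨ *-distribˡ-+ (suc (suc j)) (b (suc j)) (b (suc (suc j))) ⟩
    (b (suc j) + suc j * b (suc j)) + suc (suc j) * b (suc (suc j))
      ≡⟨ cong₂ (λ x y → (b (suc j) + x) + y) (absorption n j) (absorption n (suc j)) ⟩
    (b (suc j) + suc n * binom n j) + suc n * binom n (suc j)
      ≡⟨ +-assoc (b (suc j)) _ _ ⟩
    b (suc j) + (suc n * binom n j + suc n * binom n (suc j))
      ≡⟨ cong (b (suc j) +_) (sym (*-distribˡ-+ (suc n) (binom n j) (binom n (suc j)))) ⟩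
    suc (suc n) * b (suc j) ∎
    where
    b = binom (suc n)

  absorption′ : ∀ n j → j * binom (suc n) j ≡ suc n * lower 0 (binom n) j
  absorption′ n zero    = sym (*-zeroʳ n)
  absorption′ n (suc j) = absorption n j

  -- The ballot triangle: ballot n k is the number of Dyck-path prefixes of length n
  -- ending at height k (a walk with steps ±1 may reach k from k-1 or k+1).
  ballot : ℕ → ℕ → ℕ
  ballot zero    zero    = 1
  ballot zero    (suc k) = 0
  ballot (suc n) zero    = ballot n 1
  ballot (suc n) (suc k) = ballot n k + ballot n (suc (suc k))

  ballot-below : ∀ {n k} → n < k → ballot n k ≡ 0
  ballot-below {zero}  {suc k} _         = refl
  ballot-below {suc n} {suc k} (s≤s n<k) =
    cong₂ _+_ (ballot-below n<k) (ballot-below (m<n⇒m<1+n (m<n⇒m<1+n n<k)))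

  -- Only the all-up prefix reaches height n in n steps.
  ballot-diag : ∀ k → ballot k k ≡ 1
  ballot-diag zero    = refl
  ballot-diag (suc k) = cong₂ _+_ (ballot-diag k) (ballot-below {k} (m<n⇒m<1+n (n<1+n k)))

  -- In the coordinates n = k + 2j the recursion moves either j or k.
  shift-index : ∀ k j → suc (suc k) + j * 2 ≡ k + suc j * 2
  shift-index = solve-∀

  ballot-step : ∀ k j → ballot (suc k + suc j * 2) (suc k)
    ≡ ballot (k + suc j * 2) k + ballot (suc (suc k) + j * 2) (suc (suc k))
  ballot-step k j =
    cong (ballot (k + suc j * 2) k +_) (cong (λ n → ballot n (suc (suc k))) (sym (shift-index k j)))

  ballot-odd : ∀ j k → ballot (k + suc (j * 2)) k ≡ 0
  ballot-odd zero    zero    = refl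
  ballot-odd zero    (suc k) =
    cong₂ _+_ (ballot-odd zero k)
              (ballot-below {k + 1} (s≤s (≤-reflexive (+-comm k 1))))
  ballot-odd (suc j) zero    = ballot-odd j 1
  ballot-odd (suc j) (suc k) = cong₂ _+_ (ballot-odd (suc j) k) odd-shift
    where
    odd-shift : ballot (k + suc (suc j * 2)) (suc (suc k)) ≡ 0
    odd-shift = subst (λ n → ballot n (suc (suc k)) ≡ 0) (odd-index k j) (ballot-odd j (suc (suc k)))
      where
      odd-index : ∀ k j → suc (suc k) + suc (j * 2) ≡ k + suc (suc j * 2)
      odd-index = solve-∀

  -- Reflection principle: a ballot number is a difference of consecutive binomials,
  -- ballot (k + 2j) k = binom (k + 2j) j - binom (k + 2j) (j - 1).
  ballot-binom : ∀ j k → ballot (k + j * 2) k + lower 0 (binom (k + j * 2)) j ≡ binom (k + j * 2) j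
  ballot-binom zero    k = trans (+-identityʳ _) (subst (λ n → ballot n k ≡ 1) (sym (+-identityʳ k)) (ballot-diag k))
  ballot-binom (suc j) zero = begin
    ballot m 1 + binom (suc m) j                ≡⟨ cong (ballot m 1 +_) (pascal m j) ⟩
    ballot m 1 + (lower 0 (binom m) j + binom m j)  ≡⟨ sym (+-assoc (ballot m 1) _ _) ⟩
    (ballot m 1 + lower 0 (binom m) j) + binom m j  ≡⟨ cong (_+ binom m j) (ballot-binom j 1) ⟩
    binom m j + binom m j                       ≡⟨ cong (binom m j +_) middle-sym ⟩
    binom m j + binom m (suc j)                 ∎
    where
    m = suc (j * 2)
    middle-sym : binom m j ≡ binom m (suc j)
    middle-sym = subst (λ n → binom n j ≡ binom n (suc j)) (j+[1+j]≡1+2j j) (binom-sym j (suc j))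
      where
      j+[1+j]≡1+2j : ∀ j → j + suc j ≡ suc (j * 2)
      j+[1+j]≡1+2j = solve-∀
  ballot-binom (suc j) (suc k) = begin
    (ballot n k + ballot n (suc (suc k))) + binom (suc n) j
      ≡⟨ cong ((ballot n k + ballot n (suc (suc k))) +_) (pascal n j) ⟩
    (ballot n k + ballot n (suc (suc k))) + (lower 0 (binom n) j + binom n j)
      ≡⟨ regroup (ballot n k) (ballot n (suc (suc k))) (lower 0 (binom n) j) (binom n j) ⟩
    (ballot n k + binom n j) + (ballot n (suc (suc k)) + lower 0 (binom n) j)
      ≡⟨ cong₂ _+_ (ballot-binom (suc j) k) shifted ⟩
    binom n (suc j) + binom n j
      ≡⟨ +-comm (binom n (suc j)) (binom n j) ⟩
    binom n j + binom n (suc j) ∎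
    where
    n = k + suc j * 2
    regroup : ∀ a b c d → (a + b) + (c + d) ≡ (a + d) + (b + c)
    regroup = solve-∀
    shifted : ballot n (suc (suc k)) + lower 0 (binom n) j ≡ binom n j
    shifted = subst (λ m → ballot m (suc (suc k)) + lower 0 (binom m) j ≡ binom m j)
                    (shift-index k j) (ballot-binom j (suc (suc k)))

  ballot-closed : ∀ j k → ballot (k + j * 2) k * suc (k + j * 2) ≡ suc k * binom (suc (k + j * 2)) j
  ballot-closed j k = sym (+-cancelʳ-≡ (X + X) (suc k * Z) (ballot n k * m) chain)
    where
    n = k + j * 2
    m = suc n
    X = m * lower 0 (binom n) j
    Z = binom m j
    -- m · ballot + X = m · binom n j  and  m · Z = X + m · binom n j  and  j · Z = X
    ballot·m : m * ballot n k + X ≡ m * binom n j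
    ballot·m = trans (sym (*-distribˡ-+ m (ballot n k) _)) (cong (m *_) (ballot-binom j k))
    pascal·m : m * Z ≡ X + m * binom n j
    pascal·m = trans (cong (m *_) (pascal n j)) (*-distribˡ-+ m _ (binom n j))
    split-m : ∀ k j Z → suc k * Z + (j * Z + j * Z) ≡ suc (k + j * 2) * Z
    split-m = solve-∀
    rotate : ∀ a X → X + (a + X) ≡ a + (X + X)
    rotate = solve-∀
    chain : suc k * Z + (X + X) ≡ ballot n k * m + (X + X)
    chain = begin
      suc k * Z + (X + X)          ≡⟨ cong (λ u → suc k * Z + (u + u)) (sym (absorption′ n j)) ⟩
      suc k * Z + (j * Z + j * Z)  ≡⟨ split-m k j Z ⟩
      m * Z                        ≡⟨ pascal·m ⟩
      X + m * binom n j            ≡⟨ cong (X +_) (sym ballot·m) ⟩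
      X + (m * ballot n k + X)     ≡⟨ rotate (m * ballot n k) X ⟩
      m * ballot n k + (X + X)     ≡⟨ cong (_+ (X + X)) (*-comm m (ballot n k)) ⟩
      ballot n k * m + (X + X)     ∎

  dnkFormula : ℕ → ℕ → ℕ
  dnkFormula k r = if r % 2 ≡ᵇ 0 then ((k + 1) * (suc (k + r) C (r / 2))) / suc (k + r) else 0

  dnk-below : ∀ {n k} → n < k → dnk n k ≡ 0
  dnk-below {n} {k} n<k with n <ᵇ k in n<ᵇk
  ... | true  = refl
  ... | false = contradiction (subst T n<ᵇk (<⇒<ᵇ n<k)) (λ ())

  dnk-above : ∀ k r → dnk (k + r) k ≡ dnkFormula k r
  dnk-above k r with (k + r) <ᵇ k in k+r<ᵇk
  ... | true  = contradiction (<ᵇ⇒< (k + r) k (subst T (sym k+r<ᵇk) tt)) (≤⇒≯ (m≤m+n k r))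
  ... | false = cong (λ r′ → if r′ % 2 ≡ᵇ 0 then ((k + 1) * (suc (k + r) C (r′ / 2))) / suc (k + r) else 0)
                     (m+n∸m≡n k r)

  -- The formula equals the ballot number: by the closed form for n - k even, and
  -- both vanish for n - k odd.
  dnkFormula≡ballot : ∀ k r → dnkFormula k r ≡ ballot (k + r) k
  dnkFormula≡ballot k = parityCases (λ r → dnkFormula k r ≡ ballot (k + r) k) even odd
    where
    even : ∀ j → dnkFormula k (j * 2) ≡ ballot (k + j * 2) k
    even j rewrite m*n%n≡0 j 2 ⦃ _ ⦄ | m*n/n≡m j 2 ⦃ _ ⦄ = begin
      ((k + 1) * (suc n C j)) / suc n      ≡⟨ cong (_/ suc n) (cong₂ _*_ (+-comm k 1) (sym (binom≡C (suc n) j))) ⟩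
      (suc k * binom (suc n) j) / suc n    ≡⟨ cong (_/ suc n) (sym (ballot-closed j k)) ⟩
      (ballot n k * suc n) / suc n         ≡⟨ m*n/n≡m (ballot n k) (suc n) ⟩
      ballot n k                           ∎
      where
      n = k + j * 2
    odd : ∀ j → dnkFormula k (suc (j * 2)) ≡ ballot (k + suc (j * 2)) k
    odd j rewrite [m+kn]%n≡m%n 1 j 2 ⦃ _ ⦄ = sym (ballot-odd j k)

  dnk≡ballot : ∀ n k → dnk n k ≡ ballot n k
  dnk≡ballot n k with k ≤? n
  ... | no  k≰n = trans (dnk-below (≰⇒> k≰n)) (sym (ballot-below (≰⇒> k≰n)))
  ... | yes k≤n = subst (λ m → dnk m k ≡ ballot m k) (m+[n∸m]≡n k≤n)
                        (trans (dnk-above k (n ∸ k)) (dnkFormula≡ballot k (n ∸ k)))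

module IntegerSums where
  open import Data.Nat as ℕ using (ℕ; zero; suc; _≤_; z≤n)
  import Data.Nat.Properties as ℕ
  open import Data.Integer hiding (suc; _≤_)
  open import Data.Integer.Properties using (+-assoc; +-identityʳ; *-distribˡ-+; -1*i≡-i)
  open import Data.Integer.Tactic.RingSolver using (solve-∀)
  open import Relation.Binary.PropositionalEquality
  open import Defs using (sumTo)

  sumTo-left : ∀ n f → sumTo (suc n) f ≡ f 0 + sumTo n (λ k → f (suc k))
  sumTo-left zero    f = refl
  sumTo-left (suc n) f = trans (cong (_+ f (suc (suc n))) (sumTo-left n f)) (+-assoc (f 0) _ _)

  sumTo-extend : ∀ n f → f (suc n) ≡ 0ℤ → sumTo (suc n) f ≡ sumTo n f
  sumTo-extend n f f[1+n]≡0 = trans (cong (λ x → sumTo n f + x) f[1+n]≡0) (+-identityʳ _)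

  sumTo-congB : ∀ n f g → (∀ k → k ≤ n → f k ≡ g k) → sumTo n f ≡ sumTo n g
  sumTo-congB zero    f g f≗g = f≗g 0 z≤n
  sumTo-congB (suc n) f g f≗g =
    cong₂ _+_ (sumTo-congB n f g (λ k k≤n → f≗g k (ℕ.m≤n⇒m≤1+n k≤n))) (f≗g (suc n) ℕ.≤-refl)

  sumTo-cong : ∀ n f g → (∀ k → f k ≡ g k) → sumTo n f ≡ sumTo n g
  sumTo-cong n f g f≗g = sumTo-congB n f g (λ k _ → f≗g k)

  sumTo-0 : ∀ n → sumTo n (λ _ → 0ℤ) ≡ 0ℤ
  sumTo-0 zero    = refl
  sumTo-0 (suc n) = cong (_+ 0ℤ) (sumTo-0 n)

  sumTo-+ : ∀ n f g → sumTo n (λ k → f k + g k) ≡ sumTo n f + sumTo n g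
  sumTo-+ zero    f g = refl
  sumTo-+ (suc n) f g = trans (cong (_+ (f (suc n) + g (suc n))) (sumTo-+ n f g))
                              (interchange (sumTo n f) (sumTo n g) (f (suc n)) (g (suc n)))
    where
    interchange : ∀ a b c d → (a + b) + (c + d) ≡ (a + c) + (b + d)
    interchange = solve-∀

  sumTo-*ˡ : ∀ n a f → sumTo n (λ k → a * f k) ≡ a * sumTo n f
  sumTo-*ˡ zero    a f = refl
  sumTo-*ˡ (suc n) a f =
    trans (cong (_+ a * f (suc n)) (sumTo-*ˡ n a f)) (sym (*-distribˡ-+ a (sumTo n f) (f (suc n))))

  sumTo-− : ∀ n f g → sumTo n (λ k → f k - g k) ≡ sumTo n f - sumTo n g
  sumTo-− n f g = begin
    sumTo n (λ k → f k - g k)             ≡⟨ sumTo-+ n f (λ k → - g k) ⟩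
    sumTo n f + sumTo n (λ k → - g k)     ≡⟨ cong (λ x → sumTo n f + x) negate ⟩
    sumTo n f - sumTo n g                 ∎
    where
    open ≡-Reasoning
    negate : sumTo n (λ k → - g k) ≡ - sumTo n g
    negate = begin
      sumTo n (λ k → - g k)         ≡⟨ sumTo-cong n _ _ (λ k → sym (-1*i≡-i (g k))) ⟩
      sumTo n (λ k → -1ℤ * g k)     ≡⟨ sumTo-*ˡ n -1ℤ g ⟩
      -1ℤ * sumTo n g               ≡⟨ -1*i≡-i (sumTo n g) ⟩
      - sumTo n g                   ∎

module Transfer where
  open import Data.Nat as ℕ using (ℕ; zero; suc; _∸_; _/_; _<_; _≤?_; s≤s; z≤n)
  import Data.Nat.Properties as ℕ
  open import Data.Nat.DivMod using (m/n≡1+[m∸n]/n)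
  open import Data.Integer hiding (suc; _<_; _≤?_; _/_)
  open import Data.Integer.Properties using (pos-+; *-identityˡ; *-zeroˡ; *-zeroʳ; *-distribˡ-+)
  open import Data.Integer.Tactic.RingSolver using (solve-∀)
  open import Relation.Binary.PropositionalEquality
  open import Relation.Nullary using (yes; no)
  open ≡-Reasoning
  open import Defs using (sumTo; negOnePow)
  open Sequences
  open Ballot using (ballot; ballot-below)
  open IntegerSums

  signedBallot : ℕ → ℕ → ℤ
  signedBallot zero    zero    = 1ℤ
  signedBallot zero    (suc k) = 0ℤ
  signedBallot (suc n) k       = lower 0ℤ (signedBallot n) k - signedBallot n (suc k)

  signedBallot-below : ∀ {n k} → n < k → signedBallot n k ≡ 0ℤ
  signedBallot-below {zero}  {suc k} _ = refl
  signedBallot-below {suc n} {suc k} (s≤s n<k)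
    rewrite signedBallot-below n<k | signedBallot-below {n} {suc (suc k)} (ℕ.m<n⇒m<1+n (ℕ.m<n⇒m<1+n n<k)) = refl

  negOnePow-step : ∀ r → negOnePow (suc (suc r) / 2) ≡ -1ℤ * negOnePow (r / 2)
  negOnePow-step r = cong negOnePow (m/n≡1+[m∸n]/n {suc (suc r)} {2} (s≤s (s≤s z≤n)))

  signedBallot≡ : ∀ n k → signedBallot n k ≡ negOnePow ((n ∸ k) / 2) * + ballot n k
  signedBallot≡ zero          zero    = refl
  signedBallot≡ zero          (suc k) = refl
  signedBallot≡ (suc zero)    zero    = refl
  signedBallot≡ (suc (suc n)) zero
    rewrite signedBallot≡ (suc n) 1 | negOnePow-step n = negate (negOnePow (n / 2)) (+ ballot (suc n) 1)
    where
    negate : ∀ s b → 0ℤ - s * b ≡ (-1ℤ * s) * b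
    negate = solve-∀
  signedBallot≡ (suc n) (suc k) with suc (suc k) ≤? n
  ... | yes k+2≤n = begin
    signedBallot n k - signedBallot n (suc (suc k))
      ≡⟨ cong₂ _-_ (signedBallot≡ n k) (signedBallot≡ n (suc (suc k))) ⟩
    negOnePow ((n ∸ k) / 2) * a - negOnePow (r / 2) * b
      ≡⟨ cong (λ m → negOnePow (m / 2) * a - negOnePow (r / 2) * b) n∸k≡r+2 ⟩
    negOnePow (suc (suc r) / 2) * a - negOnePow (r / 2) * b
      ≡⟨ cong (λ s → s * a - negOnePow (r / 2) * b) (negOnePow-step r) ⟩
    (-1ℤ * negOnePow (r / 2)) * a - negOnePow (r / 2) * b
      ≡⟨ collect (negOnePow (r / 2)) a b ⟩
    (-1ℤ * negOnePow (r / 2)) * (a + b)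
      ≡⟨ cong₂ _*_ (sym (negOnePow-step r)) (sym (pos-+ (ballot n k) (ballot n (suc (suc k))))) ⟩
    negOnePow (suc (suc r) / 2) * + (ballot n k ℕ.+ ballot n (suc (suc k)))
      ≡⟨ cong (λ m → negOnePow (m / 2) * + (ballot n k ℕ.+ ballot n (suc (suc k)))) (sym n∸k≡r+2) ⟩
    negOnePow ((n ∸ k) / 2) * + (ballot n k ℕ.+ ballot n (suc (suc k))) ∎
    where
    r = n ∸ suc (suc k)
    a = + ballot n k
    b = + ballot n (suc (suc k))
    n∸k≡r+2 : n ∸ k ≡ suc (suc r)
    n∸k≡r+2 = trans (ℕ.+-∸-assoc 1 (ℕ.<⇒≤ k+2≤n)) (cong suc (ℕ.+-∸-assoc 1 k+2≤n))
    collect : ∀ s a b → (-1ℤ * s) * a - s * b ≡ (-1ℤ * s) * (a + b)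
    collect = solve-∀
  ... | no k+2≰n
    rewrite signedBallot-below (ℕ.≰⇒> k+2≰n) | ballot-below (ℕ.≰⇒> k+2≰n)
          | signedBallot≡ n k | ℕ.+-identityʳ (ballot n k) = drop-zero (negOnePow ((n ∸ k) / 2)) (+ ballot n k)
    where
    drop-zero : ∀ s a → s * a - 0ℤ ≡ s * a
    drop-zero = solve-∀

  -- Summation by parts for X ↦ X(k+1) - X(k-1): if c vanishes beyond n, the operator
  -- moves onto the coefficients, turning c into lower c - c(· + 1).
  telescope : ∀ n (c X : ℕ → ℤ) → (∀ {k} → n < k → c k ≡ 0ℤ) →
    sumTo n (λ k → c k * (X (suc k) - lower 0ℤ X k))
      ≡ sumTo (suc n) (λ k → (lower 0ℤ c k - c (suc k)) * X k)
  telescope n c X c-vanishes = begin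
    sumTo n (λ k → c k * (X (suc k) - lower 0ℤ X k))
      ≡⟨ sumTo-cong n _ _ (λ k → distribute (c k) (X (suc k)) (lower 0ℤ X k)) ⟩
    sumTo n (λ k → c k * X (suc k) - c k * lower 0ℤ X k)
      ≡⟨ sumTo-− n _ _ ⟩
    sumTo n (λ k → c k * X (suc k)) - sumTo n (λ k → c k * lower 0ℤ X k)
      ≡⟨ cong₂ _-_ raise shift ⟩
    sumTo (suc n) (λ k → lower 0ℤ c k * X k) - sumTo (suc n) (λ k → c (suc k) * X k)
      ≡⟨ sym (sumTo-− (suc n) _ _) ⟩
    sumTo (suc n) (λ k → lower 0ℤ c k * X k - c (suc k) * X k)
      ≡⟨ sumTo-cong (suc n) _ _ (λ k → sym (distribute′ (lower 0ℤ c k) (c (suc k)) (X k))) ⟩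
    sumTo (suc n) (λ k → (lower 0ℤ c k - c (suc k)) * X k) ∎
    where
    distribute : ∀ a x y → a * (x - y) ≡ a * x - a * y
    distribute = solve-∀
    distribute′ : ∀ a b x → (a - b) * x ≡ a * x - b * x
    distribute′ = solve-∀
    drop-zero : ∀ x y → 0ℤ * x + y ≡ y
    drop-zero = solve-∀
    raise : sumTo n (λ k → c k * X (suc k)) ≡ sumTo (suc n) (λ k → lower 0ℤ c k * X k)
    raise = sym (trans (sumTo-left n _) (drop-zero (X 0) _))
    -- Σ_{k≤n} c k X(k-1) = Σ_{k≤n+1} c(k+1) X k, using c(n+1) = c(n+2) = 0
    shift : sumTo n (λ k → c k * lower 0ℤ X k) ≡ sumTo (suc n) (λ k → c (suc k) * X k)
    shift = begin
      sumTo n (λ k → c k * lower 0ℤ X k)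
        ≡⟨ sym (sumTo-extend n _ (trans (cong (_* X n) (c-vanishes (ℕ.n<1+n n))) (*-zeroˡ (X n)))) ⟩
      sumTo (suc n) (λ k → c k * lower 0ℤ X k)
        ≡⟨ trans (sumTo-left n _) (drop-zero′ (c 0) _) ⟩
      sumTo n (λ k → c (suc k) * X k)
        ≡⟨ sym (sumTo-extend n _ (trans (cong (_* X (suc n)) (c-vanishes (ℕ.m<n⇒m<1+n (ℕ.n<1+n n))))
                                        (*-zeroˡ (X (suc n))))) ⟩
      sumTo (suc n) (λ k → c (suc k) * X k) ∎
      where
      drop-zero′ : ∀ a y → a * 0ℤ + y ≡ y
      drop-zero′ = solve-∀

  pos-lower : ∀ (f : ℕ → ℕ) i → + lower 0 f i ≡ lower 0ℤ (λ j → + f j) i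
  pos-lower f zero    = refl
  pos-lower f (suc i) = refl

  -- Transfer theorem: G satisfies the recursion of non-negative walks with steps ±1 in
  -- the starting height h, F that of walks which may also use a flat step of width 2,
  -- and both start from the same values.
  module _ (F G : ℕ → ℕ → ℕ)
           (G-base : ∀ h → G 0 h ≡ F 0 h)
           (G-step : ∀ n h → G (suc n) h ≡ G n (suc h) ℕ.+ lower 0 (G n) h)
           (F-step : ∀ k h → F (suc k) h ≡ F k (suc h) ℕ.+ lower 0 (F k) h ℕ.+ lower 0 (λ i → F i h) k)
           where

    F-step′ : ∀ k h → + F k (suc h) + lower 0ℤ (λ i → + F k i) h
                    ≡ + F (suc k) h - lower 0ℤ (λ i → + F i h) k
    F-step′ k h = begin
      up + down               ≡⟨ cancel up down flat ⟩
      (up + down + flat) - flat ≡⟨ cong (_- flat) (sym F-step-ℤ) ⟩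
      + F (suc k) h - flat    ∎
      where
      up   = + F k (suc h)
      down = lower 0ℤ (λ i → + F k i) h
      flat = lower 0ℤ (λ i → + F i h) k
      cancel : ∀ a b c → a + b ≡ (a + b + c) - c
      cancel = solve-∀
      F-step-ℤ : + F (suc k) h ≡ up + down + flat
      F-step-ℤ = begin
        + F (suc k) h
          ≡⟨ cong +_ (F-step k h) ⟩
        + (F k (suc h) ℕ.+ lower 0 (F k) h ℕ.+ lower 0 (λ i → F i h) k)
          ≡⟨ pos-+ (F k (suc h) ℕ.+ lower 0 (F k) h) _ ⟩
        + (F k (suc h) ℕ.+ lower 0 (F k) h) + + lower 0 (λ i → F i h) k
          ≡⟨ cong₂ _+_ (pos-+ (F k (suc h)) _) (pos-lower (λ i → F i h) k) ⟩
        up + + lower 0 (F k) h + flat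
          ≡⟨ cong (λ x → up + x + flat) (pos-lower (F k) h) ⟩
        up + down + flat ∎

    transfer : ∀ n h → + G n h ≡ sumTo n (λ k → signedBallot n k * + F k h)
    transfer zero    h = trans (cong +_ (G-base h)) (sym (*-identityˡ (+ F 0 h)))
    transfer (suc n) h = begin
      + G (suc n) h
        ≡⟨ trans (cong +_ (G-step n h)) (pos-+ (G n (suc h)) (lower 0 (G n) h)) ⟩
      + G n (suc h) + + lower 0 (G n) h
        ≡⟨ cong₂ _+_ (transfer n (suc h)) (lower-part h) ⟩
      sumTo n (λ k → c k * + F k (suc h)) + sumTo n (λ k → c k * lower 0ℤ (λ i → + F k i) h)
        ≡⟨ sym (sumTo-+ n _ _) ⟩
      sumTo n (λ k → c k * + F k (suc h) + c k * lower 0ℤ (λ i → + F k i) h)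
        ≡⟨ sumTo-cong n _ _ (λ k → trans (sym (*-distribˡ-+ (c k) _ _)) (cong (c k *_) (F-step′ k h))) ⟩
      sumTo n (λ k → c k * (+ F (suc k) h - lower 0ℤ (λ i → + F i h) k))
        ≡⟨ telescope n c (λ i → + F i h) signedBallot-below ⟩
      sumTo (suc n) (λ k → signedBallot (suc n) k * + F k h) ∎
      where
      c = signedBallot n
      lower-part : ∀ h → + lower 0 (G n) h ≡ sumTo n (λ k → c k * lower 0ℤ (λ i → + F k i) h)
      lower-part zero    = sym (trans (sumTo-cong n _ _ (λ k → *-zeroʳ (c k))) (sumTo-0 n))
      lower-part (suc h) = transfer n h

module SymmetricPaths where
  open import Data.Nat
  open import Data.Nat.Properties
  open import Data.Nat.Tactic.RingSolver using (solve-∀)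
  open import Data.Bool using (Bool; true; false; _∧_)
  open import Data.Bool.Properties using (∧-comm; ∧-idem; ∧-zeroʳ)
  open import Data.List using (List; []; _∷_; _++_; map; length; filterᵇ; [_])
  open import Data.Nat.ListAction using (sum)
  open import Data.Nat.ListAction.Properties using (sum-++)
  open import Data.List.Properties using (map-++; map-∘; map-cong; map-cong-local; unfold-reverse)
  open import Data.List.Relation.Unary.All using (All; []; _∷_) renaming (map to All-map)
  open import Data.List.Relation.Unary.All.Properties using (++⁺; map⁺)
  open import Data.Maybe using (Maybe; just; nothing; is-just; _>>=_)
  open import Data.Product using (_×_; _,_)
  open import Relation.Binary.PropositionalEquality hiding ([_])
  open ≡-Reasoning
  open import Defs
  open Sequences

  𝟙 : Bool → ℕ
  𝟙 true  = 1
  𝟙 false = 0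

  sumOver : List (List Step) → (List Step → ℕ) → ℕ
  sumOver xs f = sum (map f xs)

  count≡sumOver : ∀ P xs → length (filterᵇ P xs) ≡ sumOver xs (λ p → 𝟙 (P p))
  count≡sumOver P []       = refl
  count≡sumOver P (x ∷ xs) with P x
  ... | true  = cong suc (count≡sumOver P xs)
  ... | false = count≡sumOver P xs

  sumOver-++ : ∀ xs ys f → sumOver (xs ++ ys) f ≡ sumOver xs f + sumOver ys f
  sumOver-++ xs ys f = trans (cong sum (map-++ f xs ys)) (sum-++ (map f xs) (map f ys))

  sumOver-map : ∀ (g : List Step → List Step) xs f → sumOver (map g xs) f ≡ sumOver xs (λ x → f (g x))
  sumOver-map g xs f = cong sum (sym (map-∘ xs))

  sumOver-cong : ∀ xs {f g} → (∀ x → f x ≡ g x) → sumOver xs f ≡ sumOver xs g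
  sumOver-cong xs f≗g = cong sum (map-cong f≗g xs)

  sumOver-zero : ∀ xs → sumOver xs (λ _ → 0) ≡ 0
  sumOver-zero []       = refl
  sumOver-zero (x ∷ xs) = sumOver-zero xs

  lower-zero : ∀ m → lower 0 (λ i → sumOver (paths i) (λ _ → 0)) m ≡ 0
  lower-zero zero    = refl
  lower-zero (suc m) = sumOver-zero (paths m)

  sumOver-paths : ∀ f m → sumOver (paths (suc m)) f
    ≡ sumOver (paths m) (λ p → f (U ∷ p)) + sumOver (paths m) (λ p → f (D ∷ p))
      + lower 0 (λ i → sumOver (paths i) (λ p → f (H ∷ p))) m
  sumOver-paths f zero    = regroup (f (U ∷ [])) (f (D ∷ []))
    where
    regroup : ∀ a b → a + (b + 0) ≡ a + 0 + (b + 0) + 0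
    regroup = solve-∀
  sumOver-paths f (suc m) = begin
    sumOver (map (U ∷_) (paths (suc m)) ++ map (D ∷_) (paths (suc m)) ++ map (H ∷_) (paths m)) f
      ≡⟨ sumOver-++ (map (U ∷_) (paths (suc m))) _ f ⟩
    sumOver (map (U ∷_) (paths (suc m))) f + sumOver (map (D ∷_) (paths (suc m)) ++ map (H ∷_) (paths m)) f
      ≡⟨ cong (sumOver (map (U ∷_) (paths (suc m))) f +_) (sumOver-++ (map (D ∷_) (paths (suc m))) _ f) ⟩
    sumOver (map (U ∷_) (paths (suc m))) f + (sumOver (map (D ∷_) (paths (suc m))) f + sumOver (map (H ∷_) (paths m)) f)
      ≡⟨ sym (+-assoc (sumOver (map (U ∷_) (paths (suc m))) f) _ _) ⟩
    sumOver (map (U ∷_) (paths (suc m))) f + sumOver (map (D ∷_) (paths (suc m))) f + sumOver (map (H ∷_) (paths m)) f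
      ≡⟨ cong₂ _+_ (cong₂ _+_ (sumOver-map (U ∷_) (paths (suc m)) f) (sumOver-map (D ∷_) (paths (suc m)) f))
                   (sumOver-map (H ∷_) (paths m) f) ⟩
    sumOver (paths (suc m)) (λ p → f (U ∷ p)) + sumOver (paths (suc m)) (λ p → f (D ∷ p))
      + sumOver (paths m) (λ p → f (H ∷ p)) ∎

  wid : List Step → ℕ
  wid []      = 0
  wid (s ∷ p) = width s + wid p

  paths-width : ∀ m → All (λ p → wid p ≡ m) (paths m)
  paths-width zero          = refl ∷ []
  paths-width (suc zero)    = refl ∷ refl ∷ []
  paths-width (suc (suc m)) =
    ++⁺ (map⁺ (All-map (cong suc) (paths-width (suc m))))
        (++⁺ (map⁺ (All-map (cong suc) (paths-width (suc m))))
             (map⁺ (All-map (cong (2 +_)) (paths-width m))))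

  sumOver-paths-cong : ∀ m {f g} → (∀ p → wid p ≡ m → f p ≡ g p) → sumOver (paths m) f ≡ sumOver (paths m) g
  sumOver-paths-cong m f≗g = cong sum (map-cong-local (All-map (λ {p} → f≗g p) (paths-width m)))

  sumOver-unique : ∀ c (Q : List Step → Bool) → sumOver (paths (wid c)) (λ b → 𝟙 (listEq b c ∧ Q b)) ≡ 𝟙 (Q c)
  sumOver-unique []      Q = +-identityʳ _
  sumOver-unique (U ∷ c) Q = begin
    sumOver (paths (suc (wid c))) (λ b → 𝟙 (listEq b (U ∷ c) ∧ Q b))
      ≡⟨ sumOver-paths _ (wid c) ⟩
    sumOver (paths (wid c)) (λ b → 𝟙 (listEq b c ∧ Q (U ∷ b))) + sumOver (paths (wid c)) (λ _ → 0)
      + lower 0 (λ i → sumOver (paths i) (λ _ → 0)) (wid c)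
      ≡⟨ cong₂ _+_ (cong₂ _+_ (sumOver-unique c (λ b → Q (U ∷ b))) (sumOver-zero (paths (wid c)))) (lower-zero (wid c)) ⟩
    𝟙 (Q (U ∷ c)) + 0 + 0
      ≡⟨ trans (+-identityʳ _) (+-identityʳ _) ⟩
    𝟙 (Q (U ∷ c)) ∎
  sumOver-unique (D ∷ c) Q = begin
    sumOver (paths (suc (wid c))) (λ b → 𝟙 (listEq b (D ∷ c) ∧ Q b))
      ≡⟨ sumOver-paths _ (wid c) ⟩
    sumOver (paths (wid c)) (λ _ → 0) + sumOver (paths (wid c)) (λ b → 𝟙 (listEq b c ∧ Q (D ∷ b)))
      + lower 0 (λ i → sumOver (paths i) (λ _ → 0)) (wid c)
      ≡⟨ cong₂ _+_ (cong₂ _+_ (sumOver-zero (paths (wid c))) (sumOver-unique c (λ b → Q (D ∷ b)))) (lower-zero (wid c)) ⟩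
    𝟙 (Q (D ∷ c)) + 0
      ≡⟨ +-identityʳ _ ⟩
    𝟙 (Q (D ∷ c)) ∎
  sumOver-unique (H ∷ c) Q = begin
    sumOver (paths (suc (suc (wid c)))) (λ b → 𝟙 (listEq b (H ∷ c) ∧ Q b))
      ≡⟨ sumOver-paths _ (suc (wid c)) ⟩
    sumOver (paths (suc (wid c))) (λ _ → 0) + sumOver (paths (suc (wid c))) (λ _ → 0)
      + sumOver (paths (wid c)) (λ b → 𝟙 (listEq b c ∧ Q (H ∷ b)))
      ≡⟨ cong₂ _+_ (cong₂ _+_ (sumOver-zero (paths (suc (wid c)))) (sumOver-zero (paths (suc (wid c)))))
                   (sumOver-unique c (λ b → Q (H ∷ b))) ⟩
    𝟙 (Q (H ∷ c)) ∎

  onSplit : (List Step → List Step → ℕ) → Maybe (List Step × List Step) → ℕ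
  onSplit g (just (a , b)) = g a b
  onSplit g nothing        = 0

  onSplit-cons : ∀ g s n p → onSplit g (splitAtX (width s + n) (s ∷ p)) ≡ onSplit (λ a → g (s ∷ a)) (splitAtX n p)
  onSplit-cons g U n p with splitAtX n p
  ... | just (a , b) = refl
  ... | nothing      = refl
  onSplit-cons g D n p with splitAtX n p
  ... | just (a , b) = refl
  ... | nothing      = refl
  onSplit-cons g H n p with splitAtX n p
  ... | just (a , b) = refl
  ... | nothing      = refl

  sumOver-split : ∀ m n g → sumOver (paths (m + n)) (λ p → onSplit g (splitAtX m p))
                          ≡ sumOver (paths m) (λ a → sumOver (paths n) (g a))
  sumOver-split zero    n g = sym (+-identityʳ _)
  sumOver-split (suc m) n g = begin
    sumOver (paths (suc (m + n))) (λ p → onSplit g (splitAtX (suc m) p))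
      ≡⟨ sumOver-paths _ (m + n) ⟩
    sumOver (paths (m + n)) (λ p → onSplit g (splitAtX (suc m) (U ∷ p)))
      + sumOver (paths (m + n)) (λ p → onSplit g (splitAtX (suc m) (D ∷ p)))
      + lower 0 (λ i → sumOver (paths i) (λ p → onSplit g (splitAtX (suc m) (H ∷ p)))) (m + n)
      ≡⟨ cong₂ _+_ (cong₂ _+_ (first-step U (onSplit-cons g U m)) (first-step D (onSplit-cons g D m))) (flat-first-step m) ⟩
    sumOver (paths m) (λ a → Σg (U ∷ a)) + sumOver (paths m) (λ a → Σg (D ∷ a))
      + lower 0 (λ i → sumOver (paths i) (λ a → Σg (H ∷ a))) m
      ≡⟨ sym (sumOver-paths Σg m) ⟩
    sumOver (paths (suc m)) Σg ∎
    where
    Σg : List Step → ℕ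
    Σg a = sumOver (paths n) (g a)
    first-step : ∀ s → (∀ p → onSplit g (splitAtX (suc m) (s ∷ p)) ≡ onSplit (λ a → g (s ∷ a)) (splitAtX m p)) →
      sumOver (paths (m + n)) (λ p → onSplit g (splitAtX (suc m) (s ∷ p))) ≡ sumOver (paths m) (λ a → Σg (s ∷ a))
    first-step s split-s = trans (sumOver-cong (paths (m + n)) split-s) (sumOver-split m n (λ a → g (s ∷ a)))
    flat-first-step : ∀ m → lower 0 (λ i → sumOver (paths i) (λ p → onSplit g (splitAtX (suc m) (H ∷ p)))) (m + n)
                          ≡ lower 0 (λ i → sumOver (paths i) (λ a → Σg (H ∷ a))) m
    flat-first-step zero    = lower-zero n
    flat-first-step (suc m) = trans (sumOver-cong (paths (m + n)) (λ p → onSplit-cons g H m p))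
                                    (sumOver-split m n (λ a → g (H ∷ a)))

  split-app : ∀ n p {a b} → splitAtX n p ≡ just (a , b) → a ++ b ≡ p
  split-app zero          p       refl = refl
  split-app (suc n)       []      ()
  split-app (suc n)       (U ∷ p) e with splitAtX n p in eq
  split-app (suc n)       (U ∷ p) refl | just (a , b) = cong (U ∷_) (split-app n p eq)
  split-app (suc n)       (D ∷ p) e with splitAtX n p in eq
  split-app (suc n)       (D ∷ p) refl | just (a , b) = cong (D ∷_) (split-app n p eq)
  split-app (suc zero)    (H ∷ p) ()
  split-app (suc (suc n)) (H ∷ p) e with splitAtX n p in eq
  split-app (suc (suc n)) (H ∷ p) refl | just (a , b) = cong (H ∷_) (split-app n p eq)

  symmetric-onSplit : ∀ (P : List Step → Bool) n p →
    𝟙 (P p ∧ isSymmetric n p) ≡ onSplit (λ a b → 𝟙 (listEq b (mirror a) ∧ P (a ++ b))) (splitAtX n p)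
  symmetric-onSplit P n p with splitAtX n p in eq
  ... | just (a , b) rewrite sym (split-app n p eq) = cong 𝟙 (∧-comm (P (a ++ b)) _)
  ... | nothing      = cong 𝟙 (∧-zeroʳ (P p))

  mirror-cons : ∀ s a → mirror (s ∷ a) ≡ mirror a ++ [ flipStep s ]
  mirror-cons s a = unfold-reverse (flipStep s) (map flipStep a)

  wid-++ : ∀ xs ys → wid (xs ++ ys) ≡ wid xs + wid ys
  wid-++ []       ys = refl
  wid-++ (s ∷ xs) ys = trans (cong (width s +_) (wid-++ xs ys)) (sym (+-assoc (width s) _ _))

  wid-mirror : ∀ a → wid (mirror a) ≡ wid a
  wid-mirror []      = refl
  wid-mirror (s ∷ a) = begin
    wid (mirror (s ∷ a))                  ≡⟨ cong wid (mirror-cons s a) ⟩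
    wid (mirror a ++ [ flipStep s ])      ≡⟨ wid-++ (mirror a) _ ⟩
    wid (mirror a) + (width (flipStep s) + 0) ≡⟨ cong₂ _+_ (wid-mirror a) (trans (+-identityʳ _) (width-flip s)) ⟩
    wid a + width s                       ≡⟨ +-comm (wid a) (width s) ⟩
    width s + wid a                       ∎
    where
    width-flip : ∀ s → width (flipStep s) ≡ width s
    width-flip U = refl
    width-flip D = refl
    width-flip H = refl

  -- Splitting a sequence of width 2n at x = n and requiring the second half to be the
  -- mirror image of the first: symmetric sequences are counted by their first halves.
  symmetricCount : ∀ (P : List Step → Bool) n →
    length (filterᵇ (λ p → P p ∧ isSymmetric n p) (paths (2 * n))) ≡ sumOver (paths n) (λ a → 𝟙 (P (a ++ mirror a)))
  symmetricCount P n = begin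
    length (filterᵇ (λ p → P p ∧ isSymmetric n p) (paths (2 * n)))
      ≡⟨ count≡sumOver _ (paths (2 * n)) ⟩
    sumOver (paths (2 * n)) (λ p → 𝟙 (P p ∧ isSymmetric n p))
      ≡⟨ cong (λ m → sumOver (paths (n + m)) (λ p → 𝟙 (P p ∧ isSymmetric n p))) (+-identityʳ n) ⟩
    sumOver (paths (n + n)) (λ p → 𝟙 (P p ∧ isSymmetric n p))
      ≡⟨ sumOver-cong (paths (n + n)) (symmetric-onSplit P n) ⟩
    sumOver (paths (n + n)) (λ p → onSplit matching (splitAtX n p))
      ≡⟨ sumOver-split n n matching ⟩
    sumOver (paths n) (λ a → sumOver (paths n) (matching a))
      ≡⟨ sumOver-paths-cong n unique-match ⟩
    sumOver (paths n) (λ a → 𝟙 (P (a ++ mirror a))) ∎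
    where
    matching : List Step → List Step → ℕ
    matching a b = 𝟙 (listEq b (mirror a) ∧ P (a ++ b))
    unique-match : ∀ a → wid a ≡ n → sumOver (paths n) (matching a) ≡ 𝟙 (P (a ++ mirror a))
    unique-match a refl = subst (λ m → sumOver (paths m) (matching a) ≡ 𝟙 (P (a ++ mirror a)))
                                (wid-mirror a) (sumOver-unique (mirror a) (λ b → P (a ++ b)))

  run : ℕ → List Step → Maybe ℕ
  run h       []      = just h
  run h       (U ∷ p) = run (suc h) p
  run zero    (D ∷ p) = nothing
  run (suc h) (D ∷ p) = run h p
  run h       (H ∷ p) = run h p

  atAxis : Maybe ℕ → Bool
  atAxis (just zero) = true
  atAxis _           = false

  validFrom≡atAxis : ∀ h p → validFrom h p ≡ atAxis (run h p)
  validFrom≡atAxis zero    []      = refl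
  validFrom≡atAxis (suc h) []      = refl
  validFrom≡atAxis zero    (U ∷ p) = validFrom≡atAxis 1 p
  validFrom≡atAxis (suc h) (U ∷ p) = validFrom≡atAxis (suc (suc h)) p
  validFrom≡atAxis zero    (D ∷ p) = refl
  validFrom≡atAxis (suc h) (D ∷ p) = validFrom≡atAxis h p
  validFrom≡atAxis zero    (H ∷ p) = validFrom≡atAxis zero p
  validFrom≡atAxis (suc h) (H ∷ p) = validFrom≡atAxis (suc h) p

  run-++ : ∀ h xs ys → run h (xs ++ ys) ≡ (run h xs >>= λ g → run g ys)
  run-++ h       []       ys = refl
  run-++ h       (U ∷ xs) ys = run-++ (suc h) xs ys
  run-++ zero    (D ∷ xs) ys = refl
  run-++ (suc h) (D ∷ xs) ys = run-++ h xs ys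
  run-++ h       (H ∷ xs) ys = run-++ h xs ys

  run-mirror : ∀ a h g → run h a ≡ just g → run g (mirror a) ≡ just h
  run-mirror []      h       g refl = refl
  run-mirror (U ∷ a) h       g e
    rewrite mirror-cons U a | run-++ g (mirror a) [ D ] | run-mirror a (suc h) g e = refl
  run-mirror (D ∷ a) (suc h) g e
    rewrite mirror-cons D a | run-++ g (mirror a) [ U ] | run-mirror a h g e = refl
  run-mirror (H ∷ a) h       g e
    rewrite mirror-cons H a | run-++ g (mirror a) [ H ] | run-mirror a h g e = refl

  validFrom-symmetric : ∀ a → validFrom 0 (a ++ mirror a) ≡ is-just (run 0 a)
  validFrom-symmetric a rewrite validFrom≡atAxis 0 (a ++ mirror a) | run-++ 0 a (mirror a) with run 0 a in eq
  ... | just g  rewrite run-mirror a 0 g eq = refl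
  ... | nothing = refl

  noH-++ : ∀ xs ys → noH (xs ++ ys) ≡ noH xs ∧ noH ys
  noH-++ []       ys = refl
  noH-++ (U ∷ xs) ys = noH-++ xs ys
  noH-++ (D ∷ xs) ys = noH-++ xs ys
  noH-++ (H ∷ xs) ys = refl

  noH-mirror : ∀ a → noH (mirror a) ≡ noH a
  noH-mirror []      = refl
  noH-mirror (s ∷ a) rewrite mirror-cons s a | noH-++ (mirror a) [ flipStep s ] | noH-mirror a = last-step s
    where
    last-step : ∀ s → noH a ∧ noH [ flipStep s ] ≡ noH (s ∷ a)
    last-step U = ∧-comm (noH a) true
    last-step D = ∧-comm (noH a) true
    last-step H = ∧-comm (noH a) false

  schroederWalks : ℕ → ℕ → ℕ
  schroederWalks k h = sumOver (paths k) (λ a → 𝟙 (is-just (run h a)))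

  dyckWalks : ℕ → ℕ → ℕ
  dyckWalks k h = sumOver (paths k) (λ a → 𝟙 (noH a ∧ is-just (run h a)))

  sSym≡schroederWalks : ∀ n → sSym n ≡ schroederWalks n 0
  sSym≡schroederWalks n =
    trans (symmetricCount isSchroeder n) (sumOver-cong (paths n) (λ a → cong 𝟙 (validFrom-symmetric a)))

  dSym≡dyckWalks : ∀ n → dSym n ≡ dyckWalks n 0
  dSym≡dyckWalks n = trans (symmetricCount isDyck n) (sumOver-cong (paths n) (λ a → cong 𝟙 (symmetric-Dyck a)))
    where
    symmetric-Dyck : ∀ a → isDyck (a ++ mirror a) ≡ (noH a ∧ is-just (run 0 a))
    symmetric-Dyck a rewrite noH-++ a (mirror a) | noH-mirror a | ∧-idem (noH a) | validFrom-symmetric a = refl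

  dyckWalks-base : ∀ h → dyckWalks 0 h ≡ schroederWalks 0 h
  dyckWalks-base h = refl

  schroederWalks-step : ∀ k h → schroederWalks (suc k) h
    ≡ schroederWalks k (suc h) + lower 0 (schroederWalks k) h + lower 0 (λ i → schroederWalks i h) k
  schroederWalks-step k h = trans (sumOver-paths _ k) (cong (λ x → schroederWalks k (suc h) + x + lower 0 (λ i → schroederWalks i h) k) (down-step h))
    where
    down-step : ∀ h → sumOver (paths k) (λ p → 𝟙 (is-just (run h (D ∷ p)))) ≡ lower 0 (schroederWalks k) h
    down-step zero    = sumOver-zero (paths k)
    down-step (suc h) = refl

  dyckWalks-step : ∀ n h → dyckWalks (suc n) h ≡ dyckWalks n (suc h) + lower 0 (dyckWalks n) h
  dyckWalks-step n h = begin
    dyckWalks (suc n) h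
      ≡⟨ sumOver-paths _ n ⟩
    dyckWalks n (suc h) + sumOver (paths n) (λ p → 𝟙 (noH p ∧ is-just (run h (D ∷ p))))
      + lower 0 (λ i → sumOver (paths i) (λ _ → 0)) n
      ≡⟨ cong₂ _+_ (cong (dyckWalks n (suc h) +_) (down-step h)) (lower-zero n) ⟩
    dyckWalks n (suc h) + lower 0 (dyckWalks n) h + 0
      ≡⟨ +-identityʳ _ ⟩
    dyckWalks n (suc h) + lower 0 (dyckWalks n) h ∎
    where
    down-step : ∀ h → sumOver (paths n) (λ p → 𝟙 (noH p ∧ is-just (run h (D ∷ p)))) ≡ lower 0 (dyckWalks n) h
    down-step zero    = trans (sumOver-cong (paths n) (λ p → cong 𝟙 (∧-zeroʳ (noH p)))) (sumOver-zero (paths n))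
    down-step (suc h) = refl

module PowerSeries where
  open import Data.Nat as ℕ using (ℕ; zero; suc; _∸_; _<_; _≤?_; s≤s; z≤n)
  import Data.Nat.Properties as ℕ
  open import Data.Nat.DivMod using (m*n%n≡0; m*n/n≡m; [m+kn]%n≡m%n; m/n≡1+[m∸n]/n)
  open import Data.Bool using (true; false; if_then_else_)
  open import Data.Bool.Properties using (if-cong-then)
  open import Data.Integer hiding (suc; _<_; _≤?_)
  open import Data.Integer.Properties
    using (*-assoc; *-identityˡ; *-zeroˡ; *-zeroʳ; +-identityˡ; +-identityʳ; *-cancelˡ-≡; neg-injective; i-j≡0⇒i≡j; pos-+)
  open import Data.Integer.Tactic.RingSolver using (solve-∀)
  open import Relation.Binary.PropositionalEquality
  open import Relation.Nullary using (yes; no)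
  open ≡-Reasoning
  open import Defs
  open Sequences
  open IntegerSums
  open Ballot using (ballot; ballot-below; ballot-diag; ballot-odd; ballot-step)

  tail : Series → Series
  tail f i = f (suc i)

  ⊛-suc : ∀ f g n → (f ⊛ g) (suc n) ≡ f 0 * g (suc n) + (tail f ⊛ g) n
  ⊛-suc f g n = sumTo-left n (λ i → f i * g (suc n ∸ i))

  ⊛-congˡ : ∀ f f′ g n → (∀ i → f i ≡ f′ i) → (f ⊛ g) n ≡ (f′ ⊛ g) n
  ⊛-congˡ f f′ g n f≗f′ = sumTo-cong n _ _ (λ i → cong (_* g (n ∸ i)) (f≗f′ i))

  ⊛-congʳ : ∀ f g g′ n → (∀ i → g i ≡ g′ i) → (f ⊛ g) n ≡ (f ⊛ g′) n
  ⊛-congʳ f g g′ n g≗g′ = sumTo-cong n _ _ (λ i → cong (f i *_) (g≗g′ (n ∸ i)))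

  ⊛-zeroˡ : ∀ f g n → (∀ i → f i ≡ 0ℤ) → (f ⊛ g) n ≡ 0ℤ
  ⊛-zeroˡ f g n f≗0 = trans (sumTo-cong n _ _ (λ i → trans (cong (_* g (n ∸ i)) (f≗0 i)) (*-zeroˡ (g (n ∸ i))))) (sumTo-0 n)

  ⊛-linearˡ : ∀ a f f′ g n → ((λ i → a * f i + f′ i) ⊛ g) n ≡ a * (f ⊛ g) n + (f′ ⊛ g) n
  ⊛-linearˡ a f f′ g n = begin
    sumTo n (λ i → (a * f i + f′ i) * g (n ∸ i))
      ≡⟨ sumTo-cong n _ _ (λ i → distribute a (f i) (f′ i) (g (n ∸ i))) ⟩
    sumTo n (λ i → a * (f i * g (n ∸ i)) + f′ i * g (n ∸ i))
      ≡⟨ sumTo-+ n _ _ ⟩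
    sumTo n (λ i → a * (f i * g (n ∸ i))) + (f′ ⊛ g) n
      ≡⟨ cong (_+ (f′ ⊛ g) n) (sumTo-*ˡ n a _) ⟩
    a * (f ⊛ g) n + (f′ ⊛ g) n ∎
    where
    distribute : ∀ a x y z → (a * x + y) * z ≡ a * (x * z) + y * z
    distribute = solve-∀

  ⊛-assoc : ∀ n f g h → ((f ⊛ g) ⊛ h) n ≡ (f ⊛ (g ⊛ h)) n
  ⊛-assoc zero    f g h = *-assoc (f 0) (g 0) (h 0)
  ⊛-assoc (suc n) f g h = begin
    ((f ⊛ g) ⊛ h) (suc n)
      ≡⟨ ⊛-suc (f ⊛ g) h n ⟩
    (f 0 * g 0) * h (suc n) + (tail (f ⊛ g) ⊛ h) n
      ≡⟨ cong (λ z → (f 0 * g 0) * h (suc n) + z)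
              (trans (⊛-congˡ _ (λ i → f 0 * tail g i + (tail f ⊛ g) i) h n (λ i → ⊛-suc f g i))
                     (⊛-linearˡ (f 0) (tail g) (tail f ⊛ g) h n)) ⟩
    (f 0 * g 0) * h (suc n) + (f 0 * (tail g ⊛ h) n + ((tail f ⊛ g) ⊛ h) n)
      ≡⟨ cong (λ z → (f 0 * g 0) * h (suc n) + (f 0 * (tail g ⊛ h) n + z)) (⊛-assoc n (tail f) g h) ⟩
    (f 0 * g 0) * h (suc n) + (f 0 * (tail g ⊛ h) n + (tail f ⊛ (g ⊛ h)) n)
      ≡⟨ regroup (f 0) (g 0) (h (suc n)) ((tail g ⊛ h) n) ((tail f ⊛ (g ⊛ h)) n) ⟩
    f 0 * (g 0 * h (suc n) + (tail g ⊛ h) n) + (tail f ⊛ (g ⊛ h)) n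
      ≡⟨ cong (λ z → f 0 * z + (tail f ⊛ (g ⊛ h)) n) (sym (⊛-suc g h n)) ⟩
    f 0 * (g ⊛ h) (suc n) + (tail f ⊛ (g ⊛ h)) n
      ≡⟨ sym (⊛-suc f (g ⊛ h) n) ⟩
    (f ⊛ (g ⊛ h)) (suc n) ∎
    where
    regroup : ∀ a b c x y → (a * b) * c + (a * x + y) ≡ a * (b * c + x) + y
    regroup = solve-∀

  oneS-⊛ : ∀ g n → (oneS ⊛ g) n ≡ g n
  oneS-⊛ g zero    = *-identityˡ (g 0)
  oneS-⊛ g (suc n) = begin
    (oneS ⊛ g) (suc n)               ≡⟨ ⊛-suc oneS g n ⟩
    1ℤ * g (suc n) + (tail oneS ⊛ g) n ≡⟨ cong₂ _+_ (*-identityˡ (g (suc n))) (⊛-zeroˡ (tail oneS) g n (λ _ → refl)) ⟩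
    g (suc n) + 0ℤ                   ≡⟨ +-identityʳ _ ⟩
    g (suc n)                        ∎

  xS-⊛ : ∀ g n → (xS ⊛ g) (suc n) ≡ g n
  xS-⊛ g n = begin
    (xS ⊛ g) (suc n)                   ≡⟨ ⊛-suc xS g n ⟩
    0ℤ * g (suc n) + (tail xS ⊛ g) n   ≡⟨ cong (λ z → 0ℤ * g (suc n) + z) (trans (⊛-congˡ (tail xS) oneS g n tail-xS) (oneS-⊛ g n)) ⟩
    0ℤ * g (suc n) + g n               ≡⟨ cong (_+ g n) (*-zeroˡ (g (suc n))) ⟩
    0ℤ + g n                           ≡⟨ +-identityˡ _ ⟩
    g n                                ∎
    where
    tail-xS : ∀ i → tail xS i ≡ oneS i
    tail-xS zero    = refl
    tail-xS (suc i) = refl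

  xPow-⊛-above : ∀ k n f → (powS xS k ⊛ f) (k ℕ.+ n) ≡ f n
  xPow-⊛-above zero    n f = oneS-⊛ f n
  xPow-⊛-above (suc k) n f =
    trans (⊛-assoc (suc (k ℕ.+ n)) xS (powS xS k) f) (trans (xS-⊛ (powS xS k ⊛ f) (k ℕ.+ n)) (xPow-⊛-above k n f))

  xPow-⊛-below : ∀ k n f → n < k → (powS xS k ⊛ f) n ≡ 0ℤ
  xPow-⊛-below (suc k) zero    f _         = ⊛-assoc 0 xS (powS xS k) f
  xPow-⊛-below (suc k) (suc n) f (s≤s n<k) =
    trans (⊛-assoc (suc n) xS (powS xS k) f) (trans (xS-⊛ (powS xS k ⊛ f) n) (xPow-⊛-below k n f n<k))

  subX2-cong : ∀ f g n → (∀ i → f i ≡ g i) → subX2 f n ≡ subX2 g n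
  subX2-cong f g n f≗g = if-cong-then ((n ℕ.% 2) ℕ.≡ᵇ 0) (f≗g (n ℕ./ 2))

  subX2-even : ∀ f j → subX2 f (j ℕ.* 2) ≡ f j
  subX2-even f j rewrite m*n%n≡0 j 2 ⦃ _ ⦄ | m*n/n≡m j 2 ⦃ _ ⦄ = refl

  subX2-odd : ∀ f j → subX2 f (suc (j ℕ.* 2)) ≡ 0ℤ
  subX2-odd f j rewrite [m+kn]%n≡m%n 1 j 2 ⦃ _ ⦄ = refl

  subX2-shift : ∀ f n → subX2 f (suc (suc n)) ≡ subX2 (tail f) n
  subX2-shift f n = cong (λ i → if (n ℕ.% 2) ℕ.≡ᵇ 0 then f i else + 0) (m/n≡1+[m∸n]/n {suc (suc n)} {2} (s≤s (s≤s z≤n)))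

  subX2-linear : ∀ a f g n → subX2 (λ i → a * f i + g i) n ≡ a * subX2 f n + subX2 g n
  subX2-linear a f g n = by-parity-bit ((n ℕ.% 2) ℕ.≡ᵇ 0)
    where
    by-parity-bit : ∀ b → (if b then a * f (n ℕ./ 2) + g (n ℕ./ 2) else + 0)
                        ≡ a * (if b then f (n ℕ./ 2) else + 0) + (if b then g (n ℕ./ 2) else + 0)
    by-parity-bit true  = refl
    by-parity-bit false = sym (trans (+-identityʳ (a * 0ℤ)) (*-zeroʳ a))

  subX2-oneS : ∀ n → oneS n ≡ subX2 oneS n
  subX2-oneS zero          = refl
  subX2-oneS (suc zero)    = refl
  subX2-oneS (suc (suc n)) = sym (trans (subX2-shift oneS n) (both-zero ((n ℕ.% 2) ℕ.≡ᵇ 0)))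
    where
    both-zero : ∀ b → (if b then 0ℤ else 0ℤ) ≡ 0ℤ
    both-zero true  = refl
    both-zero false = refl

  subX2-⊛ : ∀ f g n → (subX2 f ⊛ subX2 g) n ≡ subX2 (f ⊛ g) n
  subX2-⊛ f g zero          = refl
  subX2-⊛ f g (suc zero)    = vanish (f 0) (g 0)
    where
    vanish : ∀ a b → a * 0ℤ + 0ℤ * b ≡ 0ℤ
    vanish = solve-∀
  subX2-⊛ f g (suc (suc n)) = begin
    (subX2 f ⊛ subX2 g) (suc (suc n))
      ≡⟨ trans (⊛-suc (subX2 f) (subX2 g) (suc n))
               (cong (λ z → f 0 * subX2 g (suc (suc n)) + z) (⊛-suc (tail (subX2 f)) (subX2 g) n)) ⟩
    f 0 * subX2 g (suc (suc n)) + (0ℤ * subX2 g (suc n) + (tail (tail (subX2 f)) ⊛ subX2 g) n)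
      ≡⟨ cong (λ z → f 0 * subX2 g (suc (suc n)) + (0ℤ * subX2 g (suc n) + z))
              (trans (⊛-congˡ _ _ (subX2 g) n (subX2-shift f)) (subX2-⊛ (tail f) g n)) ⟩
    f 0 * subX2 g (suc (suc n)) + (0ℤ * subX2 g (suc n) + subX2 (tail f ⊛ g) n)
      ≡⟨ drop-zero (f 0 * subX2 g (suc (suc n))) (subX2 g (suc n)) _ ⟩
    f 0 * subX2 g (suc (suc n)) + subX2 (tail f ⊛ g) n
      ≡⟨ cong (λ z → f 0 * z + subX2 (tail f ⊛ g) n) (subX2-shift g n) ⟩
    f 0 * subX2 (tail g) n + subX2 (tail f ⊛ g) n
      ≡⟨ sym (subX2-linear (f 0) (tail g) (tail f ⊛ g) n) ⟩
    subX2 (λ i → f 0 * tail g i + (tail f ⊛ g) i) n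
      ≡⟨ sym (subX2-cong _ _ n (⊛-suc f g)) ⟩
    subX2 (tail (f ⊛ g)) n
      ≡⟨ sym (subX2-shift (f ⊛ g) n) ⟩
    subX2 (f ⊛ g) (suc (suc n)) ∎
    where
    drop-zero : ∀ a y z → a + (0ℤ * y + z) ≡ a + z
    drop-zero = solve-∀

  subX2-powS : ∀ m f n → powS (subX2 f) m n ≡ subX2 (powS f m) n
  subX2-powS zero    f n = subX2-oneS n
  subX2-powS (suc m) f n = trans (⊛-congʳ (subX2 f) _ _ n (subX2-powS m f)) (subX2-⊛ f (powS f m) n)

  -- From S² = 1 - 4x, S(0) = 1 and 2xC = 1 - S, the series C is the Catalan series:
  -- it satisfies C = 1 + xC², and the coefficients of its powers are ballot numbers.
  module Catalan (C S : Series)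
    (S²≡1-4x : ∀ n → (S ⊛ S) n ≡ oneMinus4x n) (S0≡1 : S 0 ≡ + 1)
    (2xC≡1-S : ∀ n → scaleS (+ 2) (xS ⊛ C) n ≡ (oneS −S S) n) where

    S-suc : ∀ m → S (suc m) ≡ - (+ 2 * C m)
    S-suc m = trans (double-negation (S (suc m))) (cong -_ (sym 2C≡-S))
      where
      2C≡-S : + 2 * C m ≡ 0ℤ - S (suc m)
      2C≡-S = trans (cong (+ 2 *_) (sym (xS-⊛ C m))) (2xC≡1-S (suc m))
      double-negation : ∀ s → s ≡ - (0ℤ - s)
      double-negation = solve-∀

    -- Coefficient of x in S² = 1 - 4x.
    C0≡1 : C 0 ≡ 1ℤ
    C0≡1 = *-cancelˡ-≡ (+ 4) (C 0) 1ℤ (neg-injective (trans (sym (expand (C 0))) coefficient-1))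
      where
      coefficient-1 : 1ℤ * - (+ 2 * C 0) + - (+ 2 * C 0) * 1ℤ ≡ - (+ 4 * 1ℤ)
      coefficient-1 = subst (λ s → s * - (+ 2 * C 0) + - (+ 2 * C 0) * s ≡ - (+ 4 * 1ℤ)) S0≡1
                        (subst (λ s → S 0 * s + s * S 0 ≡ - (+ 4 * 1ℤ)) (S-suc 0) (S²≡1-4x 1))
      expand : ∀ c → 1ℤ * - (+ 2 * c) + - (+ 2 * c) * 1ℤ ≡ - (+ 4 * c)
      expand = solve-∀

    -- Coefficient of x^(n+2) in S² = 1 - 4x.
    C-suc : ∀ n → C (suc n) ≡ (C ⊛ C) n
    C-suc n = sym (*-cancelˡ-≡ (+ 4) ((C ⊛ C) n) (C (suc n))
                    (i-j≡0⇒i≡j _ _ (trans (expand (C (suc n)) ((C ⊛ C) n)) coefficient-n+2)))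
      where
      inner : sumTo n (λ i → S (suc i) * S (suc n ∸ i)) ≡ + 4 * (C ⊛ C) n
      inner = trans (sumTo-congB n _ _ (λ i i≤n → trans (cong (λ j → S (suc i) * S j) (ℕ.+-∸-assoc 1 i≤n))
                                          (trans (cong₂ _*_ (S-suc i) (S-suc (n ∸ i))) (product (C i) (C (n ∸ i))))))
                    (sumTo-*ˡ n (+ 4) _)
        where
        product : ∀ a b → - (+ 2 * a) * - (+ 2 * b) ≡ + 4 * (a * b)
        product = solve-∀
      S²-split : (S ⊛ S) (suc (suc n)) ≡ S 0 * S (suc (suc n)) + (+ 4 * (C ⊛ C) n + S (suc (suc n)) * S 0)
      S²-split = trans (⊛-suc S S (suc n)) (cong (λ z → S 0 * S (suc (suc n)) + z)
                   (cong₂ _+_ inner (cong (λ j → S (suc (suc n)) * S j) (ℕ.n∸n≡0 n))))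
      coefficient-n+2 : 1ℤ * - (+ 2 * C (suc n)) + (+ 4 * (C ⊛ C) n + - (+ 2 * C (suc n)) * 1ℤ) ≡ 0ℤ
      coefficient-n+2 = subst (λ s → s * - (+ 2 * C (suc n)) + (+ 4 * (C ⊛ C) n + - (+ 2 * C (suc n)) * s) ≡ 0ℤ) S0≡1
                          (subst (λ s → S 0 * s + (+ 4 * (C ⊛ C) n + s * S 0) ≡ 0ℤ) (S-suc (suc n))
                                 (trans (sym S²-split) (S²≡1-4x (suc (suc n)))))
      expand : ∀ x y → + 4 * y - + 4 * x ≡ 1ℤ * - (+ 2 * x) + (+ 4 * y + - (+ 2 * x) * 1ℤ)
      expand = solve-∀

    Cpow-zero : ∀ k → powS C k 0 ≡ 1ℤ
    Cpow-zero zero    = refl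
    Cpow-zero (suc k) = cong₂ _*_ C0≡1 (Cpow-zero k)

    -- C^(k+1) = C^k + x C^(k+2), from C = 1 + x C².
    Cpow-suc : ∀ k j → powS C (suc k) (suc j) ≡ powS C k (suc j) + powS C (suc (suc k)) j
    Cpow-suc k j = begin
      (C ⊛ powS C k) (suc j)
        ≡⟨ ⊛-suc C (powS C k) j ⟩
      C 0 * powS C k (suc j) + (tail C ⊛ powS C k) j
        ≡⟨ cong₂ _+_ (trans (cong (_* powS C k (suc j)) C0≡1) (*-identityˡ _)) (⊛-congˡ (tail C) (C ⊛ C) (powS C k) j C-suc) ⟩
      powS C k (suc j) + ((C ⊛ C) ⊛ powS C k) j
        ≡⟨ cong (λ z → powS C k (suc j) + z) (⊛-assoc j C C (powS C k)) ⟩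
      powS C k (suc j) + powS C (suc (suc k)) j ∎

    Cpow≡ballot : ∀ j k → powS C (suc k) j ≡ + ballot (k ℕ.+ j ℕ.* 2) k
    Cpow≡ballot zero    k =
      trans (Cpow-zero (suc k)) (cong +_ (sym (trans (cong (λ n → ballot n k) (ℕ.+-identityʳ k)) (ballot-diag k))))
    Cpow≡ballot (suc j) zero    = trans (Cpow-suc 0 j) (trans (+-identityˡ _) (Cpow≡ballot j 1))
    Cpow≡ballot (suc j) (suc k) = begin
      powS C (suc (suc k)) (suc j)
        ≡⟨ Cpow-suc (suc k) j ⟩
      powS C (suc k) (suc j) + powS C (suc (suc (suc k))) j
        ≡⟨ cong₂ _+_ (Cpow≡ballot (suc j) k) (Cpow≡ballot j (suc (suc k))) ⟩
      + ballot (k ℕ.+ suc j ℕ.* 2) k + + ballot (suc (suc k) ℕ.+ j ℕ.* 2) (suc (suc k))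
        ≡⟨ sym (pos-+ (ballot (k ℕ.+ suc j ℕ.* 2) k) _) ⟩
      + (ballot (k ℕ.+ suc j ℕ.* 2) k ℕ.+ ballot (suc (suc k) ℕ.+ j ℕ.* 2) (suc (suc k)))
        ≡⟨ cong +_ (sym (ballot-step k j)) ⟩
      + ballot (suc k ℕ.+ suc j ℕ.* 2) (suc k) ∎

    ballot≡coefficient : ∀ k n → + ballot n k ≡ (powS xS k ⊛ powS (subX2 C) (suc k)) n
    ballot≡coefficient k n with k ≤? n
    ... | no  k≰n = trans (cong +_ (ballot-below (ℕ.≰⇒> k≰n))) (sym (xPow-⊛-below k n (powS (subX2 C) (suc k)) (ℕ.≰⇒> k≰n)))
    ... | yes k≤n = subst (λ m → + ballot m k ≡ (powS xS k ⊛ powS (subX2 C) (suc k)) m) (ℕ.m+[n∸m]≡n k≤n)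
                          (sym (trans (xPow-⊛-above k (n ∸ k) (powS (subX2 C) (suc k)))
                                 (trans (subX2-powS (suc k) C (n ∸ k)) (parityCases coefficient even odd (n ∸ k)))))
      where
      coefficient : ℕ → Set
      coefficient r = subX2 (powS C (suc k)) r ≡ + ballot (k ℕ.+ r) k
      even : ∀ j → coefficient (j ℕ.* 2)
      even j = trans (subX2-even (powS C (suc k)) j) (Cpow≡ballot j k)
      odd : ∀ j → coefficient (suc (j ℕ.* 2))
      odd j = trans (subX2-odd (powS C (suc k)) j) (cong +_ (sym (ballot-odd j k)))

open import Defs
open import Data.Nat using (ℕ; _∸_; _/_; _+_)
open import Data.Nat.Properties using (+-comm)
open import Data.Integer using (ℤ; +_; _*_)
open import Data.Product using (_×_; _,_)
open import Relation.Binary.PropositionalEquality using (_≡_; cong; cong₂; sym; trans; module ≡-Reasoning)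
open ≡-Reasoning
open Ballot using (dnk≡ballot)
open IntegerSums using (sumTo-cong)
open Transfer using (signedBallot; signedBallot≡; transfer)
open SymmetricPaths
open PowerSeries using (module Catalan)

theorem3p4 :
    ((n : ℕ) → + dSym n ≡ sumTo n (λ k → negOnePow ((n ∸ k) / 2) * + dnk n k * + sSym k))
    × ((C S : Series) →
       ((n : ℕ) → (S ⊛ S) n ≡ oneMinus4x n) → S 0 ≡ + 1 →
       ((n : ℕ) → scaleS (+ 2) (xS ⊛ C) n ≡ (oneS −S S) n) →
       (k n : ℕ) → + dnk n k ≡ (powS xS k ⊛ powS (subX2 C) (k + 1)) n)
theorem3p4 = symmetric-count , generating-function
  where
  -- d_n counts Dyck walks of length n from height 0, s_k counts Schröder walks of
  -- width k from height 0, and the transfer theorem relates the two.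
  symmetric-count : (n : ℕ) → + dSym n ≡ sumTo n (λ k → negOnePow ((n ∸ k) / 2) * + dnk n k * + sSym k)
  symmetric-count n = begin
    + dSym n
      ≡⟨ cong +_ (dSym≡dyckWalks n) ⟩
    + dyckWalks n 0
      ≡⟨ transfer schroederWalks dyckWalks dyckWalks-base dyckWalks-step schroederWalks-step n 0 ⟩
    sumTo n (λ k → signedBallot n k * + schroederWalks k 0)
      ≡⟨ sumTo-cong n _ _ (λ k → cong₂ _*_ (signed-dnk k) (cong +_ (sym (sSym≡schroederWalks k)))) ⟩
    sumTo n (λ k → negOnePow ((n ∸ k) / 2) * + dnk n k * + sSym k) ∎
    where
    signed-dnk : ∀ k → signedBallot n k ≡ negOnePow ((n ∸ k) / 2) * + dnk n k
    signed-dnk k = trans (signedBallot≡ n k) (cong (λ d → negOnePow ((n ∸ k) / 2) * + d) (sym (dnk≡ballot n k)))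

  -- d_{n,k} is the ballot number ballot n k, which is the coefficient of x^n in x^k C(x²)^(k+1).
  generating-function : (C S : Series) →
       ((n : ℕ) → (S ⊛ S) n ≡ oneMinus4x n) → S 0 ≡ + 1 →
       ((n : ℕ) → scaleS (+ 2) (xS ⊛ C) n ≡ (oneS −S S) n) →
       (k n : ℕ) → + dnk n k ≡ (powS xS k ⊛ powS (subX2 C) (k + 1)) n
  generating-function C S S² S0 2xC k n = begin
    + dnk n k                                     ≡⟨ cong +_ (dnk≡ballot n k) ⟩
    + Ballot.ballot n k                           ≡⟨ Catalan.ballot≡coefficient C S S² S0 2xC k n ⟩
    (powS xS k ⊛ powS (subX2 C) (1 + k)) n        ≡⟨ cong (λ m → (powS xS k ⊛ powS (subX2 C) m) n) (+-comm 1 k) ⟩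
    (powS xS k ⊛ powS (subX2 C) (k + 1)) n        ∎
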